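{- Let $p>3$ be a prime and, for nonnegative integers $n\ge k$, let $$F(n,k)=(-1)^{n+k}\frac{6n-2k+1}{2^{9n-3k}}\cdot\frac{(2n+2k)!\,(2n-2k)!\,\binom{2n-2k}{n-k}}{(n+k)!\,(n-k)!\,n!^2}.$$ Then $$F\left(\frac{p-1}2,\frac{p-1}2\right)\equiv(-1)^{(p-1)/2}p\left(1-pq_p(2)+p^2q_p(2)^2\right)\pmod{p^4}.$$
   Context: $q_p(2)=(2^{p-1}-1)/p$ is the Fermat quotient. Congruences between rationals with denominators coprime to $p$ are understood in the ring of rationals with denominator prime to $p$. -}

module Defs where

open import Data.Nat as ℕ using (ℕ; zero; suc; _∸_; _!; NonZero)
open import Data.Nat.Properties using (_!≢0; m*n≢0; m^n≢0)
open import Data.Nat.Combinatorics using (_C_)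
open import Data.Nat.Divisibility using (_∣_)
open import Data.Integer as ℤ using (ℤ; +_; -[1+_])
open import Data.Rational as ℚ using (ℚ; _/_; _*_; _-_; _+_)
open import Data.Product using (Σ; _×_)
open import Relation.Nullary using (¬_)
open import Relation.Binary.PropositionalEquality using (_≡_)

ℕ→ℚ : ℕ → ℚ
ℕ→ℚ n = (+ n) / 1

ℤ→ℚ : ℤ → ℚ
ℤ→ℚ z = z / 1

sgn : ℕ → ℚ
sgn m = ℤ→ℚ (-[1+ 0 ] ℤ.^ m)

-- 1/d for d ≥ 1 (value at d = 0 is an irrelevant convention, never used)
recipℕ : ℕ → ℚ
recipℕ zero    = ℚ.0ℚ
recipℕ (suc d) = (+ 1) / suc d

-- F(n,k) = (-1)^(n+k) (6n-2k+1)/2^(9n-3k) * (2n+2k)! (2n-2k)! C(2n-2k,n-k) / ((n+k)! (n-k)! n!^2)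
-- (intended for n ≥ k, where all truncated subtractions are genuine)
F : ℕ → ℕ → ℚ
F n k =
  sgn (n ℕ.+ k)
  * ℕ→ℚ ((6 ℕ.* n ∸ 2 ℕ.* k) ℕ.+ 1)
  * ℕ→ℚ ((2 ℕ.* n ℕ.+ 2 ℕ.* k) ! ℕ.* (2 ℕ.* n ∸ 2 ℕ.* k) ! ℕ.* ((2 ℕ.* n ∸ 2 ℕ.* k) C (n ∸ k)))
  * recipℕ (2 ℕ.^ (9 ℕ.* n ∸ 3 ℕ.* k) ℕ.* (n ℕ.+ k) ! ℕ.* (n ∸ k) ! ℕ.* (n ! ℕ.* n !))

q : ℕ → ℚ
q p = ℤ→ℚ ((+ (2 ℕ.^ (p ∸ 1))) ℤ.- (+ 1)) * recipℕ p

-- x ≡ y (mod p^e) in the ring Z_(p) of rationals with denominator prime to p: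
-- d·(x − y) = p^e·u for some integer u and some natural d not divisible by p.
CongModPow : ℕ → ℕ → ℚ → ℚ → Set
CongModPow p e x y =
  Σ ℤ λ u → Σ ℕ λ d → (¬ (p ∣ d)) × (ℕ→ℚ d * (x - y) ≡ ℕ→ℚ (p ℕ.^ e) * ℤ→ℚ u)

-- Put m = (p − 1)/2. Since (2p − 1)! = p (p − 1)! ∏_{k=1}^{p−1} (p + k),
--   F(m, m) = (2p − 1)! / (2^{6m} (p − 1)! m!²) = p ∏_{k=1}^{p−1} (p + k) / (2^{6m} m!²).
-- Two congruences modulo p³ finish the computation: Wolstenholme's ∏_{k=1}^{p−1} (p + k) ≡ (p − 1)!, and Morley's
-- ∏_{k=1}^{m} (k − p) ≡ 2^{4m} m!, where m! ∏_{k=1}^{m} (k − p) = (−1)^m (p − 1)!. Together they give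
-- F(m, m) ≡ (−1)^m p / 2^{2m} = (−1)^m p / (1 + p q) (mod p⁴), and (1 + pq)(1 − pq + p²q²) = 1 + p³q³.
--
-- Both congruences come from expanding ∏ (x_k + t) = e₀ + e₁ t + e₂ t² (mod t³) at t = ±p. At t = −p the products
-- are known exactly, which leaves the quantity e₁² − 2 e₀ e₂ = ∑_k (e₀ / x_k)²; it vanishes modulo p both for
-- x = 1, …, p − 1 and for x = 1, …, m, as pairing k with 2k and with p − k shows without inverting anything mod p.
-- Fermat's 2^{p−1} ≡ 1 (mod p) falls out of comparing the products over k and over 2k at t = −p.

module Submission where

open import Algebra.Bundles using (CommutativeMonoid)
open import Data.Nat as ℕ using (ℕ; zero; suc; _≤_; _<_; _∸_; _!; s≤s; z≤n)
import Data.Nat.Properties as ℕ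
import Data.Nat.Divisibility as ℕ
open import Data.Nat.Combinatorics using (_C_)
open import Data.Nat.DivMod using (_%_; m%n<n; m≡m%n+[m/n]*n)
open import Data.Nat.Primality using (Prime; euclidsLemma; prime⇒nonZero; prime⇒irreducible)
open import Data.Nat.Tactic.RingSolver using () renaming (solve-∀ to ℕ-solve-∀)
open import Data.Integer as ℤ using (ℤ; +_)
import Data.Integer.Properties as ℤ
open import Data.Integer.Divisibility.Signed
open import Data.Integer.Tactic.RingSolver using (solve-∀)
open import Data.Product using (_,_)
open import Data.Sum using (inj₁; inj₂)
open import Function using (_∘_)
open import Relation.Binary.Bundles using (Setoid)
open import Relation.Binary.Structures using (IsEquivalence)
open import Relation.Nullary using (¬_; yes; no; contradiction)
open import Relation.Binary.PropositionalEquality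
  using (_≡_; _≢_; refl; sym; trans; cong; cong₂; subst; subst₂; module ≡-Reasoning)
open import Defs

module _ {a} {A : Set a} (_∙_ : A → A → A) (ε : A) where

  ⨁ : ℕ → (ℕ → A) → A
  ⨁ zero    f = ε
  ⨁ (suc n) f = ⨁ n f ∙ f (suc n)

module ⨁-Properties {c ℓ} (M : CommutativeMonoid c ℓ) where

  open CommutativeMonoid M renaming (refl to ≈-refl; sym to ≈-sym; trans to ≈-trans)
  open import Algebra.Properties.CommutativeSemigroup commutativeSemigroup using (interchange)
  open import Relation.Binary.Reasoning.Setoid setoid

  private
    ⨁ₘ = ⨁ _∙_ ε

  ⨁-cong : ∀ n {f g} → (∀ {k} → 1 ≤ k → k ≤ n → f k ≈ g k) → ⨁ₘ n f ≈ ⨁ₘ n g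
  ⨁-cong zero    f≈g = ≈-refl
  ⨁-cong (suc n) f≈g =
    ∙-cong (⨁-cong n (λ 1≤k k≤n → f≈g 1≤k (ℕ.m≤n⇒m≤1+n k≤n))) (f≈g (s≤s z≤n) ℕ.≤-refl)

  ⨁-split : ∀ a b f → ⨁ₘ (a ℕ.+ b) f ≈ ⨁ₘ a f ∙ ⨁ₘ b (λ k → f (a ℕ.+ k))
  ⨁-split a zero    f = begin
    ⨁ₘ (a ℕ.+ 0) f  ≡⟨ cong (λ n → ⨁ₘ n f) (ℕ.+-identityʳ a) ⟩
    ⨁ₘ a f          ≈⟨ identityʳ (⨁ₘ a f) ⟨
    ⨁ₘ a f ∙ ε      ∎
  ⨁-split a (suc b) f = begin
    ⨁ₘ (a ℕ.+ suc b) f                                   ≡⟨ cong (λ n → ⨁ₘ n f) (ℕ.+-suc a b) ⟩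
    ⨁ₘ (a ℕ.+ b) f ∙ f (suc (a ℕ.+ b))                   ≈⟨ ∙-cong (⨁-split a b f)
                                                               (reflexive (cong f (sym (ℕ.+-suc a b)))) ⟩
    ⨁ₘ a f ∙ ⨁ₘ b (λ k → f (a ℕ.+ k)) ∙ f (a ℕ.+ suc b)  ≈⟨ assoc _ _ _ ⟩
    ⨁ₘ a f ∙ ⨁ₘ (suc b) (λ k → f (a ℕ.+ k))              ∎

  ⨁-even-odd : ∀ n f → ⨁ₘ (n ℕ.+ n) f ≈ ⨁ₘ n (λ k → f (k ℕ.+ k)) ∙ ⨁ₘ n (λ k → f (k ℕ.+ k ∸ 1))
  ⨁-even-odd zero    f = ≈-sym (identityʳ ε)
  ⨁-even-odd (suc n) f = begin
    ⨁ₘ (suc n ℕ.+ suc n) f                   ≡⟨ cong (λ k → ⨁ₘ (suc k) f) (ℕ.+-suc n n) ⟩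
    ⨁ₘ (n ℕ.+ n) f ∙ f odd ∙ f (suc odd)     ≈⟨ ∙-congʳ (∙-congʳ (⨁-even-odd n f)) ⟩
    evens ∙ odds ∙ f odd ∙ f (suc odd)       ≈⟨ assoc _ _ _ ⟩
    evens ∙ odds ∙ (f odd ∙ f (suc odd))     ≈⟨ ∙-congˡ (comm _ _) ⟩
    evens ∙ odds ∙ (f (suc odd) ∙ f odd)     ≈⟨ interchange _ _ _ _ ⟩
    (evens ∙ f (suc odd)) ∙ (odds ∙ f odd)   ≡⟨ cong₂ (λ i j → (evens ∙ f i) ∙ (odds ∙ f j))
                                                   (cong suc (sym (ℕ.+-suc n n))) (sym (ℕ.+-suc n n)) ⟩
    ⨁ₘ (suc n) (λ k → f (k ℕ.+ k)) ∙ ⨁ₘ (suc n) (λ k → f (k ℕ.+ k ∸ 1)) ∎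
    where
    odd : ℕ
    odd = suc (n ℕ.+ n)
    evens odds : Carrier
    evens = ⨁ₘ n (λ k → f (k ℕ.+ k))
    odds  = ⨁ₘ n (λ k → f (k ℕ.+ k ∸ 1))

  ⨁-peel : ∀ n f → ⨁ₘ (suc n) f ≈ f 1 ∙ ⨁ₘ n (f ∘ suc)
  ⨁-peel zero    f = comm ε (f 1)
  ⨁-peel (suc n) f = ≈-trans (∙-congʳ (⨁-peel n f)) (assoc (f 1) _ _)

  ⨁-reverse : ∀ n {f g} → (∀ {i j} → 1 ≤ i → 1 ≤ j → i ℕ.+ j ≡ suc n → f i ≈ g j) →
              ⨁ₘ n f ≈ ⨁ₘ n g
  ⨁-reverse zero    f≈g = ≈-refl
  ⨁-reverse (suc n) {f} {g} f≈g = begin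
    ⨁ₘ n f ∙ f (suc n)     ≈⟨ ∙-cong (⨁-reverse n f≈g∘suc) (f≈g (s≤s z≤n) ℕ.≤-refl (ℕ.+-comm (suc n) 1)) ⟩
    ⨁ₘ n (g ∘ suc) ∙ g 1   ≈⟨ comm _ _ ⟩
    g 1 ∙ ⨁ₘ n (g ∘ suc)   ≈⟨ ⨁-peel n g ⟨
    ⨁ₘ (suc n) g           ∎
    where
    f≈g∘suc : ∀ {i j} → 1 ≤ i → 1 ≤ j → i ℕ.+ j ≡ suc n → f i ≈ g (suc j)
    f≈g∘suc {i} {j} 1≤i _ i+j≡1+n = f≈g 1≤i (s≤s z≤n) (trans (ℕ.+-suc i j) (cong suc i+j≡1+n))

module _ where

  open import Data.Integer using (_+_; _*_; _-_; -_; 0ℤ; 1ℤ; -1ℤ; _^_)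

  infix 4 _≡_mod_

  record _≡_mod_ (a b n : ℤ) : Set where
    constructor ≡-mod
    field
      ∣-difference : n ∣ a - b

  open _≡_mod_ public

  module _ {n : ℤ} where

    ≡⇒≡-mod : ∀ {a b} → a ≡ b → a ≡ b mod n
    ≡⇒≡-mod {a} refl = ≡-mod (divides 0ℤ (a-a≡0*n a n))
      where
      a-a≡0*n : ∀ a n → a - a ≡ 0ℤ * n
      a-a≡0*n = solve-∀

    ≡-mod-sym : ∀ {a b} → a ≡ b mod n → b ≡ a mod n
    ≡-mod-sym {a} {b} (≡-mod n∣a-b) = ≡-mod (subst (n ∣_) (negate a b) (∣m⇒∣-m n∣a-b))
      where
      negate : ∀ a b → - (a - b) ≡ b - a
      negate = solve-∀

    ≡-mod-trans : ∀ {a b c} → a ≡ b mod n → b ≡ c mod n → a ≡ c mod n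
    ≡-mod-trans {a} {b} {c} (≡-mod n∣a-b) (≡-mod n∣b-c) =
      ≡-mod (subst (n ∣_) (telescope a b c) (∣m∣n⇒∣m+n n∣a-b n∣b-c))
      where
      telescope : ∀ a b c → (a - b) + (b - c) ≡ a - c
      telescope = solve-∀

    ≡-mod-isEquivalence : IsEquivalence (λ a b → a ≡ b mod n)
    ≡-mod-isEquivalence = record { refl = ≡⇒≡-mod refl ; sym = ≡-mod-sym ; trans = ≡-mod-trans }

    ≡-mod-setoid : Setoid _ _
    ≡-mod-setoid = record { isEquivalence = ≡-mod-isEquivalence }

    +-cong-mod : ∀ {a b c d} → a ≡ b mod n → c ≡ d mod n → a + c ≡ b + d mod n
    +-cong-mod {a} {b} {c} {d} (≡-mod n∣a-b) (≡-mod n∣c-d) =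
      ≡-mod (subst (n ∣_) (regroup a b c d) (∣m∣n⇒∣m+n n∣a-b n∣c-d))
      where
      regroup : ∀ a b c d → (a - b) + (c - d) ≡ (a + c) - (b + d)
      regroup = solve-∀

    *-cong-mod : ∀ {a b c d} → a ≡ b mod n → c ≡ d mod n → a * c ≡ b * d mod n
    *-cong-mod {a} {b} {c} {d} (≡-mod n∣a-b) (≡-mod n∣c-d) =
      ≡-mod (subst (n ∣_) (regroup a b c d) (∣m∣n⇒∣m+n (∣m⇒∣m*n c n∣a-b) (∣n⇒∣m*n b n∣c-d)))
      where
      regroup : ∀ a b c d → (a - b) * c + b * (c - d) ≡ a * c - b * d
      regroup = solve-∀

    *-congˡ-mod : ∀ c {a b} → a ≡ b mod n → c * a ≡ c * b mod n
    *-congˡ-mod c = *-cong-mod (≡⇒≡-mod {a = c} refl)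

    ∣⇒≡0-mod : ∀ {a} → n ∣ a → a ≡ 0ℤ mod n
    ∣⇒≡0-mod {a} n∣a = ≡-mod (subst (n ∣_) (sym (ℤ.+-identityʳ a)) n∣a)

    ≡0-mod⇒∣ : ∀ {a} → a ≡ 0ℤ mod n → n ∣ a
    ≡0-mod⇒∣ {a} (≡-mod n∣a-0) = subst (n ∣_) (ℤ.+-identityʳ a) n∣a-0

    +-≡-mod-commutativeMonoid : CommutativeMonoid _ _
    +-≡-mod-commutativeMonoid = record
      { Carrier = ℤ
      ; _≈_ = λ a b → a ≡ b mod n
      ; _∙_ = _+_
      ; ε = 0ℤ
      ; isCommutativeMonoid = record
        { isMonoid = record
          { isSemigroup = record
            { isMagma = record { isEquivalence = ≡-mod-isEquivalence ; ∙-cong = +-cong-mod }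
            ; assoc = λ a b c → ≡⇒≡-mod (ℤ.+-assoc a b c) }
          ; identity = (λ a → ≡⇒≡-mod (ℤ.+-identityˡ a)) , (λ a → ≡⇒≡-mod (ℤ.+-identityʳ a)) }
        ; comm = λ a b → ≡⇒≡-mod (ℤ.+-comm a b) } }

  ≡-mod-weaken : ∀ {m n a b} → m ∣ n → a ≡ b mod n → a ≡ b mod m
  ≡-mod-weaken m∣n (≡-mod n∣a-b) = ≡-mod (∣-trans m∣n n∣a-b)

  *-monoˡ-mod : ∀ c {a b n} → a ≡ b mod n → c * a ≡ c * b mod c * n
  *-monoˡ-mod c {a} {b} (≡-mod n∣a-b) = ≡-mod (subst (c * _ ∣_) (factor c a b) (*-monoʳ-∣ c n∣a-b))
    where
    factor : ∀ c a b → c * (a - b) ≡ c * a - c * b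
    factor = solve-∀

  module _ {p : ℕ} (p-prime : Prime p) where

    private
      P : ℤ
      P = + p

    prime-divisor : ∀ {a b} → ¬ P ∣ a → P ∣ a * b → P ∣ b
    prime-divisor {a} {b} P∤a P∣ab
      with euclidsLemma ℤ.∣ a ∣ ℤ.∣ b ∣ p-prime (subst (p ℕ.∣_) (ℤ.abs-* a b) (∣⇒∣ᵤ P∣ab))
    ... | inj₁ p∣a = contradiction (∣ᵤ⇒∣ p∣a) P∤a
    ... | inj₂ p∣b = ∣ᵤ⇒∣ p∣b

    ∤-* : ∀ {a b} → ¬ P ∣ a → ¬ P ∣ b → ¬ P ∣ a * b
    ∤-* P∤a P∤b P∣ab = P∤b (prime-divisor P∤a P∣ab)

    prime-power-divisor : ∀ k {a b} → ¬ P ∣ a → P ^ k ∣ a * b → P ^ k ∣ b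
    prime-power-divisor zero    {b = b} _ _ = divides b (sym (ℤ.*-identityʳ b))
    prime-power-divisor (suc k) {a} {b} P∤a P^k+1∣ab
      with prime-divisor P∤a (∣-trans (∣m⇒∣m*n (P ^ k) ∣-refl) P^k+1∣ab)
    ... | divides c refl = subst (P ^ suc k ∣_) (ℤ.*-comm P c) (*-monoʳ-∣ P P^k∣c)
      where
      instance _ = prime⇒nonZero p-prime
      swap : ∀ a c p → a * (c * p) ≡ p * (a * c)
      swap = solve-∀
      P^k∣c : P ^ k ∣ c
      P^k∣c = prime-power-divisor k P∤a (*-cancelˡ-∣ P (subst (P ^ suc k ∣_) (swap a c P) P^k+1∣ab))

    *-cancelˡ-mod : ∀ k {a x y} → ¬ P ∣ a → a * x ≡ a * y mod P ^ k → x ≡ y mod P ^ k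
    *-cancelˡ-mod k {a} {x} {y} P∤a (≡-mod P^k∣ax-ay) =
      ≡-mod (prime-power-divisor k P∤a (subst (P ^ k ∣_) (factor a x y) P^k∣ax-ay))
      where
      factor : ∀ a x y → a * x - a * y ≡ a * (x - y)
      factor = solve-∀

    *-cancelˡ-mod-prime : ∀ {a x y} → ¬ P ∣ a → a * x ≡ a * y mod P → x ≡ y mod P
    *-cancelˡ-mod-prime P∤a ax≡ay = ≡-mod-weaken (∣-reflexive (sym (ℤ.*-identityʳ P)))
      (*-cancelˡ-mod 1 P∤a (≡-mod-weaken (∣-reflexive (ℤ.*-identityʳ P)) ax≡ay))

  ∑ ∏ : ℕ → (ℕ → ℤ) → ℤ
  ∑ = ⨁ _+_ 0ℤ
  ∏ = ⨁ _*_ 1ℤ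

  open ⨁-Properties ℤ.+-0-commutativeMonoid public using ()
    renaming (⨁-cong to ∑-cong; ⨁-split to ∑-split; ⨁-even-odd to ∑-even-odd)
  open ⨁-Properties ℤ.*-1-commutativeMonoid public using ()
    renaming (⨁-cong to ∏-cong; ⨁-split to ∏-split; ⨁-even-odd to ∏-even-odd; ⨁-reverse to ∏-reverse)

  module _ {n : ℤ} where
    open ⨁-Properties (+-≡-mod-commutativeMonoid {n}) public using ()
      renaming (⨁-cong to ∑-cong-mod; ⨁-reverse to ∑-reverse-mod)

  *-distribˡ-∑ : ∀ n c f → c * ∑ n f ≡ ∑ n (λ k → c * f k)
  *-distribˡ-∑ zero    c f = ℤ.*-zeroʳ c
  *-distribˡ-∑ (suc n) c f =
    trans (ℤ.*-distribˡ-+ c (∑ n f) (f (suc n))) (cong (_+ c * f (suc n)) (*-distribˡ-∑ n c f))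

  -- e₁ n x and e₂ n x are the coefficients of t and t² in ∏ n (λ k → x k + t), i.e. the elementary
  -- symmetric functions of x 1, …, x n of degrees n − 1 and n − 2.
  e₁ e₂ : ℕ → (ℕ → ℤ) → ℤ
  e₁ zero    x = 0ℤ
  e₁ (suc n) x = e₁ n x * x (suc n) + ∏ n x
  e₂ zero    x = 0ℤ
  e₂ (suc n) x = e₂ n x * x (suc n) + e₁ n x

  ∏-expansion : ∀ n x t → ∏ n (λ k → x k + t) ≡ ∏ n x + e₁ n x * t + e₂ n x * (t * t) mod t ^ 3
  ∏-expansion zero    x t = ≡⇒≡-mod (pad 1ℤ t)
    where
    pad : ∀ a t → a ≡ a + 0ℤ * t + 0ℤ * (t * t)
    pad = solve-∀
  ∏-expansion (suc n) x t = ≡-mod-trans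
    (*-cong-mod (∏-expansion n x t) (≡⇒≡-mod {a = x (suc n) + t} refl))
    (≡-mod (divides (e₂ n x) (expand (∏ n x) (e₁ n x) (e₂ n x) (x (suc n)) t)))
    where
    expand : ∀ a b c y t → (a + b * t + c * (t * t)) * (y + t) - (a * y + (b * y + a) * t + (c * y + b) * (t * t))
                           ≡ c * (t * (t * (t * 1ℤ)))
    expand = solve-∀

  ∏-expansion⁻ : ∀ n x t → ∏ n (λ k → x k - t) ≡ ∏ n x - e₁ n x * t + e₂ n x * (t * t) mod t ^ 3
  ∏-expansion⁻ n x t = subst (λ r → ∏ n (λ k → x k - t) ≡ r mod t ^ 3) (negate (∏ n x) (e₁ n x) (e₂ n x) t)
    (≡-mod-weaken (divides -1ℤ (cube-of-negation t)) (∏-expansion n x (- t)))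
    where
    negate : ∀ a b c t → a + b * (- t) + c * (- t * - t) ≡ a - b * t + c * (t * t)
    negate = solve-∀
    cube-of-negation : ∀ t → - t * (- t * (- t * 1ℤ)) ≡ -1ℤ * (t * (t * (t * 1ℤ)))
    cube-of-negation = solve-∀

  ∏-shift-mod : ∀ n x t → ∏ n (λ k → x k - t) ≡ ∏ n x mod t
  ∏-shift-mod n x t = ≡-mod-trans (≡-mod-weaken (divides (t * t) (cube t)) (∏-expansion⁻ n x t))
    (≡-mod (divides (e₂ n x * t - e₁ n x) (factor (∏ n x) (e₁ n x) (e₂ n x) t)))
    where
    cube : ∀ t → t * (t * (t * 1ℤ)) ≡ t * t * t
    cube = solve-∀
    factor : ∀ a b c t → a - b * t + c * (t * t) - a ≡ (c * t - b) * t
    factor = solve-∀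

  module _ (c : ℤ) (x : ℕ → ℤ) where

    private
      cx : ℕ → ℤ
      cx k = c * x k

    ∏-scale : ∀ n → ∏ n cx ≡ c ^ n * ∏ n x
    ∏-scale zero    = sym (ℤ.*-identityˡ 1ℤ)
    ∏-scale (suc n) = begin
      ∏ n cx * (c * x (suc n))         ≡⟨ cong (_* (c * x (suc n))) (∏-scale n) ⟩
      c ^ n * ∏ n x * (c * x (suc n))  ≡⟨ regroup (c ^ n) (∏ n x) c (x (suc n)) ⟩
      c * c ^ n * (∏ n x * x (suc n))  ∎
      where
      open ≡-Reasoning
      regroup : ∀ u a c y → u * a * (c * y) ≡ c * u * (a * y)
      regroup = solve-∀

    e₁-scale : ∀ n → e₁ n cx * c ≡ c ^ n * e₁ n x
    e₁-scale zero    = ℤ.*-zeroˡ c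
    e₁-scale (suc n) = begin
      (e₁ n cx * (c * x (suc n)) + ∏ n cx) * c                ≡⟨ distribute (e₁ n cx) c (x (suc n)) (∏ n cx) ⟩
      e₁ n cx * c * (c * x (suc n)) + c * ∏ n cx              ≡⟨ cong₂ (λ u v → u * (c * x (suc n)) + c * v)
                                                                     (e₁-scale n) (∏-scale n) ⟩
      c ^ n * e₁ n x * (c * x (suc n)) + c * (c ^ n * ∏ n x)  ≡⟨ collect (c ^ n) (e₁ n x) c (x (suc n)) (∏ n x) ⟩
      c * c ^ n * (e₁ n x * x (suc n) + ∏ n x)                ∎
      where
      open ≡-Reasoning
      distribute : ∀ e c y a → (e * (c * y) + a) * c ≡ e * c * (c * y) + c * a
      distribute = solve-∀
      collect : ∀ u e c y a → u * e * (c * y) + c * (u * a) ≡ c * u * (e * y + a)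
      collect = solve-∀

    e₂-scale : ∀ n → e₂ n cx * (c * c) ≡ c ^ n * e₂ n x
    e₂-scale zero    = ℤ.*-zeroˡ (c * c)
    e₂-scale (suc n) = begin
      (e₂ n cx * (c * x (suc n)) + e₁ n cx) * (c * c)          ≡⟨ distribute (e₂ n cx) c (x (suc n)) (e₁ n cx) ⟩
      e₂ n cx * (c * c) * (c * x (suc n)) + c * (e₁ n cx * c)  ≡⟨ cong₂ (λ u v → u * (c * x (suc n)) + c * v)
                                                                      (e₂-scale n) (e₁-scale n) ⟩
      c ^ n * e₂ n x * (c * x (suc n)) + c * (c ^ n * e₁ n x)  ≡⟨ collect (c ^ n) (e₂ n x) c (x (suc n)) (e₁ n x) ⟩
      c * c ^ n * (e₂ n x * x (suc n) + e₁ n x)                ∎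
      where
      open ≡-Reasoning
      distribute : ∀ e c y a → (e * (c * y) + a) * (c * c) ≡ e * (c * c) * (c * y) + c * (a * c)
      distribute = solve-∀
      collect : ∀ u e c y a → u * e * (c * y) + c * (u * a) ≡ c * u * (e * y + a)
      collect = solve-∀

  cofactor : ℕ → (ℕ → ℤ) → ℕ → ℤ
  cofactor zero    x k = 1ℤ
  cofactor (suc n) x k with k ℕ.≟ suc n
  ... | yes _ = ∏ n x
  ... | no  _ = cofactor n x k * x (suc n)

  module _ (x : ℕ → ℤ) where

    cofactor-last : ∀ n → cofactor (suc n) x (suc n) ≡ ∏ n x
    cofactor-last n with suc n ℕ.≟ suc n
    ... | yes _   = refl
    ... | no  n≢n = contradiction refl n≢n

    cofactor-below : ∀ n {k} → k ≤ n → cofactor (suc n) x k ≡ cofactor n x k * x (suc n)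
    cofactor-below n {k} k≤n with k ℕ.≟ suc n
    ... | yes refl = contradiction k≤n (ℕ.n≮n n)
    ... | no  _    = refl

    *-cofactor : ∀ n {k} → 1 ≤ k → k ≤ n → x k * cofactor n x k ≡ ∏ n x
    *-cofactor zero    {suc _} _ ()
    *-cofactor (suc n) {k} 1≤k k≤1+n with k ℕ.≟ suc n
    ... | yes refl  = ℤ.*-comm (x (suc n)) (∏ n x)
    ... | no  k≢1+n = begin
      x k * (cofactor n x k * x (suc n))  ≡⟨ ℤ.*-assoc (x k) _ _ ⟨
      x k * cofactor n x k * x (suc n)    ≡⟨ cong (_* x (suc n)) (*-cofactor n 1≤k k≤n) ⟩
      ∏ n x * x (suc n)                   ∎
      where
      open ≡-Reasoning
      k≤n : k ≤ n
      k≤n = ℕ.≤-pred (ℕ.≤∧≢⇒< k≤1+n k≢1+n)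

    ∏*cofactor-comm : ∀ {n n′ k} → 1 ≤ k → k ≤ n → k ≤ n′ →
                      ∏ n x * cofactor n′ x k ≡ ∏ n′ x * cofactor n x k
    ∏*cofactor-comm {n} {n′} {k} 1≤k k≤n k≤n′ = begin
      ∏ n x * cofactor n′ x k                 ≡⟨ cong (_* cofactor n′ x k) (*-cofactor n 1≤k k≤n) ⟨
      x k * cofactor n x k * cofactor n′ x k  ≡⟨ swap (x k) (cofactor n x k) (cofactor n′ x k) ⟩
      x k * cofactor n′ x k * cofactor n x k  ≡⟨ cong (_* cofactor n x k) (*-cofactor n′ 1≤k k≤n′) ⟩
      ∏ n′ x * cofactor n x k                 ∎
      where
      open ≡-Reasoning
      swap : ∀ y c c′ → y * c * c′ ≡ y * c′ * c
      swap = solve-∀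

    e₁²-2∏e₂≡∑cofactor² : ∀ n →
      e₁ n x * e₁ n x - + 2 * ∏ n x * e₂ n x ≡ ∑ n (λ k → cofactor n x k * cofactor n x k)
    e₁²-2∏e₂≡∑cofactor² zero    = refl
    e₁²-2∏e₂≡∑cofactor² (suc n) = begin
      (e₁ n x * y + a) * (e₁ n x * y + a) - + 2 * (a * y) * (e₂ n x * y + e₁ n x)
        ≡⟨ expand (e₁ n x) (e₂ n x) a y ⟩
      y * y * (e₁ n x * e₁ n x - + 2 * a * e₂ n x) + a * a
        ≡⟨ cong₂ (λ s c → y * y * s + c * c) (e₁²-2∏e₂≡∑cofactor² n) (sym (cofactor-last n)) ⟩
      y * y * ∑ n (λ k → cofactor n x k * cofactor n x k) + cofactor (suc n) x (suc n) * cofactor (suc n) x (suc n)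
        ≡⟨ cong (_+ cofactor (suc n) x (suc n) * cofactor (suc n) x (suc n)) y²∑≡∑ ⟩
      ∑ (suc n) (λ k → cofactor (suc n) x k * cofactor (suc n) x k) ∎
      where
      open ≡-Reasoning
      a y : ℤ
      a = ∏ n x
      y = x (suc n)
      expand : ∀ e f a y → (e * y + a) * (e * y + a) - + 2 * (a * y) * (f * y + e)
                           ≡ y * y * (e * e - + 2 * a * f) + a * a
      expand = solve-∀
      square-product : ∀ y c → y * y * (c * c) ≡ c * y * (c * y)
      square-product = solve-∀
      y²∑≡∑ : y * y * ∑ n (λ k → cofactor n x k * cofactor n x k)
              ≡ ∑ n (λ k → cofactor (suc n) x k * cofactor (suc n) x k)
      y²∑≡∑ = trans (*-distribˡ-∑ n (y * y) _) (∑-cong n λ {k} _ k≤n →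
        trans (square-product y (cofactor n x k)) (sym (cong₂ _*_ (cofactor-below n k≤n) (cofactor-below n k≤n))))

  pos-^ : ∀ a n → + (a ℕ.^ n) ≡ (+ a) ^ n
  pos-^ a zero    = refl
  pos-^ a (suc n) = trans (ℤ.pos-* a (a ℕ.^ n)) (cong (+ a *_) (pos-^ a n))

  -1^n*-1^n≡1 : ∀ n → -1ℤ ^ n * -1ℤ ^ n ≡ 1ℤ
  -1^n*-1^n≡1 zero    = refl
  -1^n*-1^n≡1 (suc n) = trans (square-of-negation (-1ℤ ^ n)) (-1^n*-1^n≡1 n)
    where
    square-of-negation : ∀ x → -1ℤ * x * (-1ℤ * x) ≡ x * x
    square-of-negation = solve-∀

  -1^[n+n]≡1 : ∀ n → -1ℤ ^ (n ℕ.+ n) ≡ 1ℤ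
  -1^[n+n]≡1 n = trans (ℤ.^-distribˡ-+-* -1ℤ n n) (-1^n*-1^n≡1 n)

  ∏-pos≡! : ∀ n → ∏ n (λ k → + k) ≡ + (n !)
  ∏-pos≡! zero    = refl
  ∏-pos≡! (suc n) = begin
    ∏ n (λ k → + k) * + suc n  ≡⟨ cong (_* + suc n) (∏-pos≡! n) ⟩
    + (n !) * + suc n          ≡⟨ ℤ.*-comm (+ (n !)) (+ suc n) ⟩
    + suc n * + (n !)          ≡⟨ ℤ.pos-* (suc n) (n !) ⟨
    + (suc n !)                ∎
    where open ≡-Reasoning

  !*∏-rising : ∀ a n → + (a !) * ∏ n (λ k → + k + + a) ≡ + ((a ℕ.+ n) !)
  !*∏-rising a n = begin
    + (a !) * ∏ n (λ k → + k + + a)             ≡⟨ cong₂ _*_ (∏-pos≡! a) (∏-cong n λ {k} _ _ → pos-+-comm k) ⟨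
    ∏ a (λ k → + k) * ∏ n (λ k → + (a ℕ.+ k))  ≡⟨ ∏-split a n (λ k → + k) ⟨
    ∏ (a ℕ.+ n) (λ k → + k)                     ≡⟨ ∏-pos≡! (a ℕ.+ n) ⟩
    + ((a ℕ.+ n) !)                             ∎
    where
    open ≡-Reasoning
    pos-+-comm : ∀ k → + (a ℕ.+ k) ≡ + k + + a
    pos-+-comm k = trans (cong +_ (ℕ.+-comm a k)) (ℤ.pos-+ k a)

  ∏-reflect : ∀ n {f g} → (∀ {i j} → 1 ≤ i → 1 ≤ j → i ℕ.+ j ≡ suc n → f i ≡ - g j) →
              ∏ n f ≡ -1ℤ ^ n * ∏ n g
  ∏-reflect n {f} {g} f≡-g =
    trans (∏-reverse n λ 1≤i 1≤j i+j≡1+n → trans (f≡-g 1≤i 1≤j i+j≡1+n) (sym (ℤ.-1*i≡-i _))) (∏-scale -1ℤ g n)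

module OddPrime (m : ℕ) (p-prime : Prime (suc (m ℕ.+ m))) (3<p : 3 < suc (m ℕ.+ m)) where

  open import Data.Integer using (_+_; _*_; _-_; -_; 0ℤ; 1ℤ; -1ℤ; _^_)

  p N : ℕ
  p = suc (m ℕ.+ m)
  N = m ℕ.+ m

  P W h T σ : ℤ
  P = + p
  W = + (N !)
  h = + (m !)
  T = (+ 2) ^ m
  σ = -1ℤ ^ m

  3≤N : 3 ≤ N
  3≤N = ℕ.≤-pred 3<p

  1≤N : 1 ≤ N
  1≤N = ℕ.≤-trans (s≤s z≤n) 3≤N

  P∤ : ∀ {k} → 1 ≤ k → k ≤ N → ¬ P ∣ + k
  P∤ {suc k} _ k<p = ℕ.>⇒∤ (s≤s k<p) ∘ ∣⇒∣ᵤ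

  P∤! : ∀ {k} → k ≤ N → ¬ P ∣ + (k !)
  P∤! {zero}  _     = P∤ ℕ.≤-refl 1≤N
  P∤! {suc k} 1+k≤N = subst (λ z → ¬ P ∣ z) (sym (ℤ.pos-* (suc k) (k !)))
                        (∤-* p-prime (P∤ (s≤s z≤n) 1+k≤N) (P∤! (ℕ.≤-trans (ℕ.n≤1+n k) 1+k≤N)))

  P∤W : ¬ P ∣ W
  P∤W = P∤! ℕ.≤-refl

  P∤h : ¬ P ∣ h
  P∤h = P∤! (ℕ.m≤m+n m m)

  P∤2 : ¬ P ∣ + 2
  P∤2 = P∤ (s≤s z≤n) (ℕ.≤-trans (ℕ.n≤1+n 2) 3≤N)

  P∤3 : ¬ P ∣ + 3
  P∤3 = P∤ (s≤s z≤n) 3≤N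

  P∤2^ : ∀ k → ¬ P ∣ (+ 2) ^ k
  P∤2^ zero    = P∤! {zero} z≤n
  P∤2^ (suc k) = ∤-* p-prime P∤2 (P∤2^ k)

  P∤T^ : ∀ k → ¬ P ∣ T ^ k
  P∤T^ zero    = P∤2^ 0
  P∤T^ (suc k) = ∤-* p-prime (P∤2^ m) (P∤T^ k)

  pos-split : ∀ i j {n} → i ℕ.+ j ≡ n → + n ≡ + i + + j
  pos-split i j refl = ℤ.pos-+ i j

  pos-≡-mod-P : ∀ {a b} → a ≡ b ℕ.+ p → + a ≡ + b mod P
  pos-≡-mod-P {a} {b} a≡b+p =
    ≡-mod (divides 1ℤ (trans (cong (_- + b) (pos-split b p (sym a≡b+p))) (cancel (+ b) P)))
    where
    cancel : ∀ b p → b + p - b ≡ 1ℤ * p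
    cancel = solve-∀

  D : ℕ → ℕ → ℤ
  D n = cofactor n (λ k → + k)

  -- Multiplying b·D n i and D n j by b·j gives b·n! on both sides modulo p, as i·D n i = j·D n j = n!.
  cofactor-ratio² : ∀ {n i j} b → n ≤ N → 1 ≤ i → i ≤ n → 1 ≤ j → j ≤ n → ¬ P ∣ b →
                    b * + j ≡ + i mod P → b * b * (D n i * D n i) ≡ D n j * D n j mod P
  cofactor-ratio² {n} {i} {j} b n≤N 1≤i i≤n 1≤j j≤n P∤b bj≡i =
    ≡-mod-trans (≡⇒≡-mod (square b (D n i))) (*-cong-mod bDᵢ≡Dⱼ bDᵢ≡Dⱼ)
    where
    open import Relation.Binary.Reasoning.Setoid (≡-mod-setoid {P})
    square : ∀ b d → b * b * (d * d) ≡ b * d * (b * d)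
    square = solve-∀
    swap : ∀ i b d → i * (b * d) ≡ b * (i * d)
    swap = solve-∀
    bDᵢ≡Dⱼ : b * D n i ≡ D n j mod P
    bDᵢ≡Dⱼ = *-cancelˡ-mod-prime p-prime (∤-* p-prime P∤b (P∤ 1≤j (ℕ.≤-trans j≤n n≤N))) (begin
      b * + j * (b * D n i)  ≈⟨ *-cong-mod bj≡i (≡⇒≡-mod refl) ⟩
      + i * (b * D n i)      ≡⟨ swap (+ i) b (D n i) ⟩
      b * (+ i * D n i)      ≡⟨ cong (b *_) (trans (*-cofactor (λ k → + k) n 1≤i i≤n)
                                                   (sym (*-cofactor (λ k → + k) n 1≤j j≤n))) ⟩
      b * (+ j * D n j)      ≡⟨ ℤ.*-assoc b (+ j) (D n j) ⟨
      b * + j * D n j        ∎)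

  private
    f : ℕ → ℤ
    f k = D N k * D N k

    4f[2k]≡f[k] : ∀ {k} → 1 ≤ k → k ≤ m → + 2 * + 2 * f (k ℕ.+ k) ≡ f k mod P
    4f[2k]≡f[k] {k} 1≤k k≤m =
      cofactor-ratio² (+ 2) ℕ.≤-refl (ℕ.≤-trans 1≤k (ℕ.m≤m+n k k)) (ℕ.+-mono-≤ k≤m k≤m)
        1≤k (ℕ.≤-trans k≤m (ℕ.m≤m+n m m)) P∤2 (≡⇒≡-mod (trans (double (+ k)) (sym (ℤ.pos-+ k k))))
      where
      double : ∀ x → + 2 * x ≡ x + x
      double = solve-∀

    4f[2k-1]≡f[m+k] : ∀ {k} → 1 ≤ k → k ≤ m → + 2 * + 2 * f (k ℕ.+ k ∸ 1) ≡ f (m ℕ.+ k) mod P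
    4f[2k-1]≡f[m+k] {suc k} _ 1+k≤m =
      cofactor-ratio² (+ 2) ℕ.≤-refl
        (subst (1 ≤_) (sym (ℕ.+-suc k k)) (s≤s z≤n))
        (ℕ.≤-trans (ℕ.m∸n≤m (suc k ℕ.+ suc k) 1) (ℕ.+-mono-≤ 1+k≤m 1+k≤m))
        (ℕ.≤-trans (s≤s z≤n) (ℕ.m≤n+m (suc k) m)) (ℕ.+-monoʳ-≤ m 1+k≤m) P∤2
        (subst (_≡ _ mod P) (ℤ.pos-* 2 (m ℕ.+ suc k)) (pos-≡-mod-P (index-identity m k)))
      where
      index-identity : ∀ m k → 2 ℕ.* (m ℕ.+ suc k) ≡ k ℕ.+ suc k ℕ.+ suc (m ℕ.+ m)
      index-identity = ℕ-solve-∀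

    f[m+i]≡f[j] : ∀ {i j} → 1 ≤ i → 1 ≤ j → i ℕ.+ j ≡ suc m → f (m ℕ.+ i) ≡ f j mod P
    f[m+i]≡f[j] {i} {j} 1≤i 1≤j i+j≡1+m = ≡-mod-trans (≡⇒≡-mod (sym (ℤ.*-identityˡ (f (m ℕ.+ i)))))
      (cofactor-ratio² -1ℤ ℕ.≤-refl (ℕ.≤-trans 1≤i (ℕ.m≤n+m i m)) (ℕ.+-monoʳ-≤ m i≤m)
        1≤j (ℕ.≤-trans j≤m (ℕ.m≤m+n m m)) (P∤ ℕ.≤-refl 1≤N ∘ ∣m⇒∣-m) -j≡m+i)
      where
      i≤m : i ≤ m
      i≤m = ℕ.≤-pred (subst (i <_) i+j≡1+m (ℕ.m<m+n i 1≤j))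
      j≤m : j ≤ m
      j≤m = ℕ.≤-pred (subst (j <_) (trans (ℕ.+-comm j i) i+j≡1+m) (ℕ.m<m+n j 1≤i))
      regroup : ∀ i j m → -1ℤ * j - (m + i) ≡ -1ℤ * (m + (i + j))
      regroup = solve-∀
      -j≡m+i : -1ℤ * + j ≡ + (m ℕ.+ i) mod P
      -j≡m+i = ≡-mod (divides -1ℤ (begin
        -1ℤ * + j - + (m ℕ.+ i)    ≡⟨ cong (λ z → -1ℤ * + j - z) (ℤ.pos-+ m i) ⟩
        -1ℤ * + j - (+ m + + i)    ≡⟨ regroup (+ i) (+ j) (+ m) ⟩
        -1ℤ * (+ m + (+ i + + j))  ≡⟨ cong (λ z → -1ℤ * (+ m + z)) (sym (pos-split i j i+j≡1+m)) ⟩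
        -1ℤ * (+ m + + suc m)      ≡⟨ cong (-1ℤ *_) (sym (pos-split m (suc m) (ℕ.+-suc m m))) ⟩
        -1ℤ * P                    ∎))
        where open ≡-Reasoning

  -- Pairing k with 2k, and 2k − 1 with m + k (as 2 (m + k) = p + 2k − 1), shows 4S ≡ S.
  P∣∑cofactor² : P ∣ ∑ N (λ k → D N k * D N k)
  P∣∑cofactor² = prime-divisor p-prime P∤3 (subst (P ∣_) (4s-s≡3s (∑ N f)) (∣-difference 4S≡S))
    where
    open import Relation.Binary.Reasoning.Setoid (≡-mod-setoid {P})
    4s-s≡3s : ∀ s → + 2 * + 2 * s - s ≡ + 3 * s
    4s-s≡3s = solve-∀
    evens odds : ℤ
    evens = ∑ m (λ k → f (k ℕ.+ k))
    odds  = ∑ m (λ k → f (k ℕ.+ k ∸ 1))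
    4S≡S : + 2 * + 2 * ∑ N f ≡ ∑ N f mod P
    4S≡S = begin
      + 2 * + 2 * ∑ N f
        ≡⟨ cong (+ 2 * + 2 *_) (∑-even-odd m f) ⟩
      + 2 * + 2 * (evens + odds)
        ≡⟨ ℤ.*-distribˡ-+ (+ 2 * + 2) evens odds ⟩
      + 2 * + 2 * evens + + 2 * + 2 * odds
        ≡⟨ cong₂ _+_ (*-distribˡ-∑ m (+ 2 * + 2) (λ k → f (k ℕ.+ k)))
                     (*-distribˡ-∑ m (+ 2 * + 2) (λ k → f (k ℕ.+ k ∸ 1))) ⟩
      ∑ m (λ k → + 2 * + 2 * f (k ℕ.+ k)) + ∑ m (λ k → + 2 * + 2 * f (k ℕ.+ k ∸ 1))
        ≈⟨ +-cong-mod (∑-cong-mod m 4f[2k]≡f[k]) (∑-cong-mod m 4f[2k-1]≡f[m+k]) ⟩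
      ∑ m f + ∑ m (λ k → f (m ℕ.+ k))
        ≡⟨ ∑-split m m f ⟨
      ∑ N f ∎

  -- Pairing m + i with m + 1 − i shows ∑ N f ≡ 2 ∑ m f; and m! · D N k = (2m)! · D m k.
  P∣∑cofactor²-half : P ∣ ∑ m (λ k → D m k * D m k)
  P∣∑cofactor²-half = prime-divisor p-prime (∤-* p-prime P∤W P∤W)
    (subst (P ∣_) h²∑f≡W²∑D² (∣n⇒∣m*n (h * h) (prime-divisor p-prime P∤2 (≡0-mod⇒∣ 2∑f≡0))))
    where
    2∑f≡0 : + 2 * ∑ m f ≡ 0ℤ mod P
    2∑f≡0 = begin
      + 2 * ∑ m f                      ≡⟨ double (∑ m f) ⟩
      ∑ m f + ∑ m f                    ≈⟨ +-cong-mod (≡⇒≡-mod {a = ∑ m f} refl) (∑-reverse-mod m f[m+i]≡f[j]) ⟨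
      ∑ m f + ∑ m (λ k → f (m ℕ.+ k))  ≡⟨ ∑-split m m f ⟨
      ∑ N f                            ≈⟨ ∣⇒≡0-mod P∣∑cofactor² ⟩
      0ℤ                               ∎
      where
      open import Relation.Binary.Reasoning.Setoid (≡-mod-setoid {P})
      double : ∀ s → + 2 * s ≡ s + s
      double = solve-∀
    hDᴺ≡WDᵐ : ∀ {k} → 1 ≤ k → k ≤ m → h * D N k ≡ W * D m k
    hDᴺ≡WDᵐ {k} 1≤k k≤m = subst₂ (λ a b → a * D N k ≡ b * D m k) (∏-pos≡! m) (∏-pos≡! N)
      (∏*cofactor-comm (λ k → + k) 1≤k k≤m (ℕ.≤-trans k≤m (ℕ.m≤m+n m m)))
    square-both : ∀ a b {x y} → a * x ≡ b * y → a * a * (x * x) ≡ b * b * (y * y)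
    square-both a b {x} {y} ax≡by = trans (square a x) (trans (cong₂ _*_ ax≡by ax≡by) (sym (square b y)))
      where
      square : ∀ a x → a * a * (x * x) ≡ a * x * (a * x)
      square = solve-∀
    h²∑f≡W²∑D² : h * h * ∑ m f ≡ W * W * ∑ m (λ k → D m k * D m k)
    h²∑f≡W²∑D² = begin
      h * h * ∑ m f                        ≡⟨ *-distribˡ-∑ m (h * h) f ⟩
      ∑ m (λ k → h * h * f k)              ≡⟨ ∑-cong m (λ 1≤k k≤m → square-both h W (hDᴺ≡WDᵐ 1≤k k≤m)) ⟩
      ∑ m (λ k → W * W * (D m k * D m k))  ≡⟨ *-distribˡ-∑ m (W * W) (λ k → D m k * D m k) ⟨
      W * W * ∑ m (λ k → D m k * D m k)    ∎
      where open ≡-Reasoning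

  ∏[k-p]≡W : ∏ N (λ k → + k - P) ≡ W
  ∏[k-p]≡W = begin
    ∏ N (λ k → + k - P)        ≡⟨ ∏-reflect N (λ {i} {j} _ _ i+j≡p →
                                     trans (cong (λ z → + i - z) (pos-split i j i+j≡p)) (cancel (+ i) (+ j))) ⟩
    -1ℤ ^ N * ∏ N (λ k → + k)  ≡⟨ cong₂ _*_ (-1^[n+n]≡1 m) (∏-pos≡! N) ⟩
    1ℤ * W                     ≡⟨ ℤ.*-identityˡ W ⟩
    W                          ∎
    where
    open ≡-Reasoning
    cancel : ∀ i j → i - (i + j) ≡ - j
    cancel = solve-∀

  -- The value of the product at −p forces p² ∣ e₁ − p e₂. With p ∣ e₁² − 2 (p − 1)! e₂ this gives p ∣ e₂ and
  -- p² ∣ e₁, so that the expansion at +p collapses modulo p³.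
  private
    e₁ᴺ e₂ᴺ : ℤ
    e₁ᴺ = e₁ N (λ k → + k)
    e₂ᴺ = e₂ N (λ k → + k)

    W≡W-e₁P+e₂P² : W ≡ W - e₁ᴺ * P + e₂ᴺ * (P * P) mod P ^ 3
    W≡W-e₁P+e₂P² = subst₂ (_≡_mod P ^ 3) ∏[k-p]≡W (cong (λ a → a - e₁ᴺ * P + e₂ᴺ * (P * P)) (∏-pos≡! N))
                     (∏-expansion⁻ N (λ k → + k) P)

    P²∣e₁-Pe₂ : P ^ 2 ∣ e₁ᴺ - P * e₂ᴺ
    P²∣e₁-Pe₂ = *-cancelˡ-∣ P (subst (P ^ 3 ∣_) (factor W e₁ᴺ e₂ᴺ P) (∣-difference W≡W-e₁P+e₂P²))
      where
      instance _ = prime⇒nonZero p-prime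
      factor : ∀ w a b p → w - (w - a * p + b * (p * p)) ≡ p * (a - p * b)
      factor = solve-∀

    P∣e₁ : P ∣ e₁ᴺ
    P∣e₁ = subst (P ∣_) (cancel e₁ᴺ (P * e₂ᴺ))
             (∣m∣n⇒∣m+n (∣-trans (∣m⇒∣m*n (P ^ 1) ∣-refl) P²∣e₁-Pe₂) (∣m⇒∣m*n e₂ᴺ ∣-refl))
      where
      cancel : ∀ a b → a - b + b ≡ a
      cancel = solve-∀

    P∣e₂ : P ∣ e₂ᴺ
    P∣e₂ = prime-divisor p-prime (∤-* p-prime P∤2 P∤W)
             (subst (P ∣_) (cancel e₁ᴺ (+ 2 * W * e₂ᴺ)) (∣m∣n⇒∣m-n (∣m⇒∣m*n e₁ᴺ P∣e₁) P∣e₁²-2We₂))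
      where
      P∣e₁²-2We₂ : P ∣ e₁ᴺ * e₁ᴺ - + 2 * W * e₂ᴺ
      P∣e₁²-2We₂ = subst (λ w → P ∣ e₁ᴺ * e₁ᴺ - + 2 * w * e₂ᴺ) (∏-pos≡! N)
                     (subst (P ∣_) (sym (e₁²-2∏e₂≡∑cofactor² (λ k → + k) N)) P∣∑cofactor²)
      cancel : ∀ a b → a * a - (a * a - b) ≡ b
      cancel = solve-∀

    P²∣e₁ : P ^ 2 ∣ e₁ᴺ
    P²∣e₁ = subst (P ^ 2 ∣_) (cancel e₁ᴺ (P * e₂ᴺ)) (∣m∣n⇒∣m+n P²∣e₁-Pe₂ P²∣Pe₂)
      where
      cancel : ∀ a b → a - b + b ≡ a
      cancel = solve-∀
      P²∣Pe₂ : P ^ 2 ∣ P * e₂ᴺ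
      P²∣Pe₂ = subst (_∣ P * e₂ᴺ) (cong (P *_) (sym (ℤ.*-identityʳ P))) (*-monoʳ-∣ P P∣e₂)

  wolstenholme : ∏ N (λ k → + k + P) ≡ W mod P ^ 3
  wolstenholme = begin
    ∏ N (λ k → + k + P)                        ≈⟨ ∏-expansion N (λ k → + k) P ⟩
    ∏ N (λ k → + k) + e₁ᴺ * P + e₂ᴺ * (P * P)  ≡⟨ cong (λ w → w + e₁ᴺ * P + e₂ᴺ * (P * P)) (∏-pos≡! N) ⟩
    W + e₁ᴺ * P + e₂ᴺ * (P * P)                ≈⟨ +-cong-mod (+-cong-mod (≡⇒≡-mod {a = W} refl) e₁ᴺP≡0) e₂ᴺP²≡0 ⟩
    W + 0ℤ + 0ℤ                                ≡⟨ drop-zeros W ⟩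
    W                                          ∎
    where
    open import Relation.Binary.Reasoning.Setoid (≡-mod-setoid {P ^ 3})
    drop-zeros : ∀ w → w + 0ℤ + 0ℤ ≡ w
    drop-zeros = solve-∀
    e₁ᴺP≡0 : e₁ᴺ * P ≡ 0ℤ mod P ^ 3
    e₁ᴺP≡0 = ∣⇒≡0-mod (subst (_∣ e₁ᴺ * P) (ℤ.*-comm (P ^ 2) P) (*-monoˡ-∣ P P²∣e₁))
    e₂ᴺP²≡0 : e₂ᴺ * (P * P) ≡ 0ℤ mod P ^ 3
    e₂ᴺP²≡0 = ∣⇒≡0-mod (subst (_∣ e₂ᴺ * (P * P)) (cong (λ z → P * (P * z)) (sym (ℤ.*-identityʳ P)))
                                (*-monoˡ-∣ (P * P) P∣e₂))

  ∏[k-p]≡σ∏[k+m] : ∏ m (λ k → + k - P) ≡ σ * ∏ m (λ k → + k + + m)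
  ∏[k-p]≡σ∏[k+m] = ∏-reflect m λ {i} {j} _ _ i+j≡1+m → begin
    + i - P                    ≡⟨ cong (λ z → + i - z) (pos-split (i ℕ.+ j) m (cong (ℕ._+ m) i+j≡1+m)) ⟩
    + i - (+ (i ℕ.+ j) + + m)  ≡⟨ cong (λ z → + i - (z + + m)) (ℤ.pos-+ i j) ⟩
    + i - (+ i + + j + + m)    ≡⟨ cancel (+ i) (+ j) (+ m) ⟩
    - (+ j + + m)              ∎
    where
    open ≡-Reasoning
    cancel : ∀ i j m → i - (i + j + m) ≡ - (j + m)
    cancel = solve-∀

  ∏[2k-p]≡σ∏odd : ∏ m (λ k → + 2 * + k - P) ≡ σ * ∏ m (λ k → + (k ℕ.+ k ∸ 1))
  ∏[2k-p]≡σ∏odd = ∏-reflect m reflect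
    where
    cancel : ∀ i o → + 2 * i - (i + i + o) ≡ - o
    cancel = solve-∀
    reflect : ∀ {i j} → 1 ≤ i → 1 ≤ j → i ℕ.+ j ≡ suc m → + 2 * + i - P ≡ - + (j ℕ.+ j ∸ 1)
    reflect {i} {suc j} _ _ i+j≡1+m = begin
      + 2 * + i - P                    ≡⟨ cong (λ z → + 2 * + i - z) (pos-split (i ℕ.+ i) o p≡2i+o) ⟩
      + 2 * + i - (+ (i ℕ.+ i) + + o)  ≡⟨ cong (λ z → + 2 * + i - (z + + o)) (ℤ.pos-+ i i) ⟩
      + 2 * + i - (+ i + + i + + o)    ≡⟨ cancel (+ i) (+ o) ⟩
      - + o                            ∎
      where
      open ≡-Reasoning
      o : ℕ
      o = j ℕ.+ suc j
      index-identity : ∀ i j → i ℕ.+ i ℕ.+ (j ℕ.+ suc j) ≡ suc (i ℕ.+ j ℕ.+ (i ℕ.+ j))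
      index-identity = ℕ-solve-∀
      p≡2i+o : i ℕ.+ i ℕ.+ o ≡ p
      p≡2i+o = trans (index-identity i j)
                     (cong (λ n → suc (n ℕ.+ n)) (ℕ.suc-injective (trans (sym (ℕ.+-suc i j)) i+j≡1+m)))

  ∏[2k]≡T*h : ∏ m (λ k → + 2 * + k) ≡ T * h
  ∏[2k]≡T*h = trans (∏-scale (+ 2) (λ k → + k) m) (cong (T *_) (∏-pos≡! m))

  W≡T*h*∏odd : W ≡ T * h * ∏ m (λ k → + (k ℕ.+ k ∸ 1))
  W≡T*h*∏odd = begin
    W                                                      ≡⟨ ∏-pos≡! N ⟨
    ∏ N (λ k → + k)                                        ≡⟨ ∏-even-odd m (λ k → + k) ⟩
    ∏ m (λ k → + (k ℕ.+ k)) * ∏ m (λ k → + (k ℕ.+ k ∸ 1))  ≡⟨ cong (_* ∏ m (λ k → + (k ℕ.+ k ∸ 1))) ∏[k+k]≡T*h ⟩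
    T * h * ∏ m (λ k → + (k ℕ.+ k ∸ 1))                    ∎
    where
    open ≡-Reasoning
    double : ∀ x → x + x ≡ + 2 * x
    double = solve-∀
    ∏[k+k]≡T*h : ∏ m (λ k → + (k ℕ.+ k)) ≡ T * h
    ∏[k+k]≡T*h = trans (∏-cong m λ {k} _ _ → trans (ℤ.pos-+ k k) (double (+ k))) ∏[2k]≡T*h

  ∏[k-p]≡T*∏[2k-p] : ∏ m (λ k → + k - P) ≡ T * ∏ m (λ k → + 2 * + k - P)
  ∏[k-p]≡T*∏[2k-p] = begin
    ∏ m (λ k → + k - P)                      ≡⟨ ∏[k-p]≡σ∏[k+m] ⟩
    σ * ∏ m (λ k → + k + + m)                ≡⟨ cong (σ *_) ∏[k+m]≡T∏odd ⟩
    σ * (T * ∏ m (λ k → + (k ℕ.+ k ∸ 1)))    ≡⟨ swap σ T _ ⟩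
    T * (σ * ∏ m (λ k → + (k ℕ.+ k ∸ 1)))    ≡⟨ cong (T *_) ∏[2k-p]≡σ∏odd ⟨
    T * ∏ m (λ k → + 2 * + k - P)            ∎
    where
    open ≡-Reasoning
    instance _ = m ℕ.!≢0
    swap : ∀ s t x → s * (t * x) ≡ t * (s * x)
    swap = solve-∀
    reassociate : ∀ t h x → t * h * x ≡ h * (t * x)
    reassociate = solve-∀
    ∏[k+m]≡T∏odd : ∏ m (λ k → + k + + m) ≡ T * ∏ m (λ k → + (k ℕ.+ k ∸ 1))
    ∏[k+m]≡T∏odd = ℤ.*-cancelˡ-≡ h _ _ (trans (!*∏-rising m m) (trans W≡T*h*∏odd (reassociate T h _)))

  h*∏[k-p]≡σ*W : h * ∏ m (λ k → + k - P) ≡ σ * W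
  h*∏[k-p]≡σ*W = trans (cong (h *_) ∏[k-p]≡σ∏[k+m]) (trans (swap h σ _) (cong (σ *_) (!*∏-rising m m)))
    where
    swap : ∀ h s x → h * (s * x) ≡ s * (h * x)
    swap = solve-∀

  -- X and T·Y are the expansions of a and 4b at t = −p modulo p³; the coefficients for the
  -- points 2k are 2^{m−i} times those for the points k.
  private
    a b c₁ c₂ X Y : ℤ
    a = ∏ m (λ k → + k - P)
    b = ∏ m (λ k → + 2 * + k - P)
    c₁ = e₁ m (λ k → + k)
    c₂ = e₂ m (λ k → + k)
    X = h - c₁ * P + c₂ * (P * P)
    Y = + 4 * h - + 2 * c₁ * P + c₂ * (P * P)

    a≡X : a ≡ X mod P ^ 3
    a≡X = subst (λ c₀ → a ≡ c₀ - c₁ * P + c₂ * (P * P) mod P ^ 3) (∏-pos≡! m) (∏-expansion⁻ m (λ k → + k) P)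

    4b≡TY : + 4 * b ≡ T * Y mod P ^ 3
    4b≡TY = ≡-mod-trans (*-congˡ-mod (+ 4) (∏-expansion⁻ m 2x P)) (≡⇒≡-mod (begin
      + 4 * (∏ m 2x - d₁ * P + d₂ * (P * P))
        ≡⟨ distribute (∏ m 2x) d₁ d₂ P ⟩
      + 4 * ∏ m 2x - + 2 * (d₁ * + 2) * P + d₂ * (+ 2 * + 2) * (P * P)
        ≡⟨ cong (λ u → + 4 * u - + 2 * (d₁ * + 2) * P + d₂ * (+ 2 * + 2) * (P * P)) ∏[2k]≡T*h ⟩
      + 4 * (T * h) - + 2 * (d₁ * + 2) * P + d₂ * (+ 2 * + 2) * (P * P)
        ≡⟨ cong₂ (λ u v → + 4 * (T * h) - + 2 * u * P + v * (P * P))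
                 (e₁-scale (+ 2) (λ k → + k) m) (e₂-scale (+ 2) (λ k → + k) m) ⟩
      + 4 * (T * h) - + 2 * (T * c₁) * P + T * c₂ * (P * P)
        ≡⟨ collect T h c₁ c₂ P ⟩
      T * Y ∎))
      where
      open ≡-Reasoning
      2x : ℕ → ℤ
      2x k = + 2 * + k
      d₁ d₂ : ℤ
      d₁ = e₁ m 2x
      d₂ = e₂ m 2x
      distribute : ∀ a d e p → + 4 * (a - d * p + e * (p * p))
                               ≡ + 4 * a - + 2 * (d * + 2) * p + e * (+ 2 * + 2) * (p * p)
      distribute = solve-∀
      collect : ∀ t h c d p → + 4 * (t * h) - + 2 * (t * c) * p + t * d * (p * p)
                              ≡ t * (+ 4 * h - + 2 * c * p + d * (p * p))
      collect = solve-∀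

    Y²≡16hX : Y * Y ≡ + 16 * h * X mod P ^ 3
    Y²≡16hX = ≡-mod (subst (P ^ 3 ∣_) (sym (expand h c₁ c₂ P))
                (∣m∣n⇒∣m+n (∣-trans (divides (+ 4) (reassociate P)) (*-monoʳ-∣ (+ 4 * (P * P)) P∣G))
                           (∣m⇒∣m*n (c₂ * c₂ * P - + 4 * c₁ * c₂) ∣-refl)))
      where
      expand : ∀ h c d p → (+ 4 * h - + 2 * c * p + d * (p * p)) * (+ 4 * h - + 2 * c * p + d * (p * p))
                           - + 16 * h * (h - c * p + d * (p * p))
                           ≡ + 4 * (p * p) * (c * c - + 2 * h * d) + p * (p * (p * 1ℤ)) * (d * d * p - + 4 * c * d)
      expand = solve-∀
      reassociate : ∀ p → + 4 * (p * p) * p ≡ + 4 * (p * (p * (p * 1ℤ)))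
      reassociate = solve-∀
      P∣G : P ∣ c₁ * c₁ - + 2 * h * c₂
      P∣G = subst (λ c₀ → P ∣ c₁ * c₁ - + 2 * c₀ * c₂) (∏-pos≡! m)
              (subst (P ∣_) (sym (e₁²-2∏e₂≡∑cofactor² (λ k → + k) m)) P∣∑cofactor²-half)

    P∤a : ¬ P ∣ a
    P∤a P∣a = P∤W (subst (P ∣_) (cancel-sign σ W (-1^n*-1^n≡1 m))
                           (∣n⇒∣m*n σ (subst (P ∣_) h*∏[k-p]≡σ*W (∣n⇒∣m*n h P∣a))))
      where
      cancel-sign : ∀ s w → s * s ≡ 1ℤ → s * (s * w) ≡ w
      cancel-sign s w s²≡1 = trans (sym (ℤ.*-assoc s s w)) (trans (cong (_* w) s²≡1) (ℤ.*-identityˡ w))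

  morley : ∏ m (λ k → + k - P) ≡ T ^ 4 * h mod P ^ 3
  morley = *-cancelˡ-mod p-prime 3 (∤-* p-prime (P∤2^ 4) P∤a) (begin
    + 16 * a * a                     ≡⟨ cong (λ z → + 16 * z * z) ∏[k-p]≡T*∏[2k-p] ⟩
    + 16 * (T * b) * (T * b)         ≡⟨ regroup T b ⟩
    T * (+ 4 * b) * (T * (+ 4 * b))  ≈⟨ *-cong-mod (*-congˡ-mod T 4b≡TY) (*-congˡ-mod T 4b≡TY) ⟩
    T * (T * Y) * (T * (T * Y))      ≡⟨ collect T Y ⟩
    T ^ 4 * (Y * Y)                  ≈⟨ *-congˡ-mod (T ^ 4) Y²≡16hX ⟩
    T ^ 4 * (+ 16 * h * X)           ≡⟨ ℤ.*-assoc (T ^ 4) (+ 16 * h) X ⟨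
    T ^ 4 * (+ 16 * h) * X           ≈⟨ *-congˡ-mod (T ^ 4 * (+ 16 * h)) a≡X ⟨
    T ^ 4 * (+ 16 * h) * a           ≡⟨ regroup′ T h a ⟩
    + 16 * a * (T ^ 4 * h)           ∎)
    where
    open import Relation.Binary.Reasoning.Setoid (≡-mod-setoid {P ^ 3})
    regroup : ∀ t b → + 16 * (t * b) * (t * b) ≡ t * (+ 4 * b) * (t * (+ 4 * b))
    regroup = solve-∀
    collect : ∀ t y → t * (t * y) * (t * (t * y)) ≡ t * (t * (t * (t * 1ℤ))) * (y * y)
    collect = solve-∀
    regroup′ : ∀ t h a → t * (t * (t * (t * 1ℤ))) * (+ 16 * h) * a ≡ + 16 * a * (t * (t * (t * (t * 1ℤ))) * h)
    regroup′ = solve-∀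

  fermat : T * T ≡ 1ℤ mod P
  fermat = *-cancelˡ-mod-prime p-prime P∤h (begin
    h * (T * T)  ≡⟨ swap h T ⟩
    T * (T * h)  ≈⟨ *-congˡ-mod T (subst (λ c₀ → b ≡ c₀ mod P) ∏[2k]≡T*h (∏-shift-mod m (λ k → + 2 * + k) P)) ⟨
    T * b        ≡⟨ ∏[k-p]≡T*∏[2k-p] ⟨
    a            ≈⟨ subst (λ c₀ → a ≡ c₀ mod P) (∏-pos≡! m) (∏-shift-mod m (λ k → + k) P) ⟩
    h            ≡⟨ ℤ.*-identityʳ h ⟨
    h * 1ℤ       ∎)
    where
    open import Relation.Binary.Reasoning.Setoid (≡-mod-setoid {P})
    swap : ∀ h t → h * (t * t) ≡ t * (t * h)
    swap = solve-∀

  s : ℤ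
  s = _∣_.quotient (∣-difference fermat)

  T²-1≡sP : T * T - 1ℤ ≡ s * P
  T²-1≡sP = _∣_.equality (∣-difference fermat)

  T²≡1+sP : T * T ≡ 1ℤ + s * P
  T²≡1+sP = trans (add-sub (T * T)) (cong (λ x → 1ℤ + x) T²-1≡sP)
    where
    add-sub : ∀ x → x ≡ 1ℤ + (x - 1ℤ)
    add-sub = solve-∀

  W≡σ*h*∏[k-p] : W ≡ σ * (h * ∏ m (λ k → + k - P))
  W≡σ*h*∏[k-p] = sym (begin
    σ * (h * ∏ m (λ k → + k - P))  ≡⟨ cong (σ *_) h*∏[k-p]≡σ*W ⟩
    σ * (σ * W)                    ≡⟨ ℤ.*-assoc σ σ W ⟨
    σ * σ * W                      ≡⟨ cong (_* W) (-1^n*-1^n≡1 m) ⟩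
    1ℤ * W                         ≡⟨ ℤ.*-identityˡ W ⟩
    W                              ∎)
    where open ≡-Reasoning

  -- The step introducing 1 + s P rests on (1 + ps)(1 − ps + p²s²) = 1 + p³s³.
  main-congruence : P * W * ∏ N (λ k → + k + P) ≡ T ^ 6 * W * (h * h) * (σ * P * (1ℤ - P * s + P ^ 2 * (s * s)))
                      mod P ^ 4
  main-congruence = subst₂ (_≡_mod P ^ 4) (sym (ℤ.*-assoc P W _)) (regroup T W h σ P s) (*-monoˡ-mod P (begin
    W * ∏ N (λ k → + k + P)   ≈⟨ *-congˡ-mod W wolstenholme ⟩
    W * W                     ≡⟨ cong (W *_) W≡σ*h*∏[k-p] ⟩
    W * (σ * (h * a))         ≡⟨ reassociate W σ h a ⟩
    W * σ * h * a             ≈⟨ *-congˡ-mod (W * σ * h) morley ⟩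
    W * σ * h * (T ^ 4 * h)   ≈⟨ ≡-mod (divides (- (W * σ * h * h * T ^ 4 * (s * s * s))) (cube-difference W σ h T s P)) ⟩
    T ^ 4 * (1ℤ + s * P) * W * (h * h) * (σ * (1ℤ - P * s + P ^ 2 * (s * s)))
      ≡⟨ cong (λ t → T ^ 4 * t * W * (h * h) * (σ * (1ℤ - P * s + P ^ 2 * (s * s)))) T²≡1+sP ⟨
    T ^ 4 * (T * T) * W * (h * h) * (σ * (1ℤ - P * s + P ^ 2 * (s * s))) ∎))
    where
    open import Relation.Binary.Reasoning.Setoid (≡-mod-setoid {P ^ 3})
    reassociate : ∀ w s h a → w * (s * (h * a)) ≡ w * s * h * a
    reassociate = solve-∀
    cube-difference : ∀ w σ h t s p →
      w * σ * h * (t * (t * (t * (t * 1ℤ))) * h)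
      - t * (t * (t * (t * 1ℤ))) * (1ℤ + s * p) * w * (h * h) * (σ * (1ℤ - p * s + p * (p * 1ℤ) * (s * s)))
      ≡ - (w * σ * h * h * (t * (t * (t * (t * 1ℤ)))) * (s * s * s)) * (p * (p * (p * 1ℤ)))
    cube-difference = solve-∀
    regroup : ∀ t w h σ p s →
      p * (t * (t * (t * (t * 1ℤ))) * (t * t) * w * (h * h) * (σ * (1ℤ - p * s + p * (p * 1ℤ) * (s * s))))
      ≡ t * (t * (t * (t * (t * (t * 1ℤ))))) * w * (h * h) * (σ * p * (1ℤ - p * s + p * (p * 1ℤ) * (s * s)))
    regroup = solve-∀

  num₁ num₂ den : ℕ
  num₁ = 6 ℕ.* m ∸ 2 ℕ.* m ℕ.+ 1
  num₂ = (2 ℕ.* m ℕ.+ 2 ℕ.* m) ! ℕ.* (2 ℕ.* m ∸ 2 ℕ.* m) ! ℕ.* ((2 ℕ.* m ∸ 2 ℕ.* m) C (m ∸ m))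
  den  = 2 ℕ.^ (9 ℕ.* m ∸ 3 ℕ.* m) ℕ.* (m ℕ.+ m) ! ℕ.* (m ∸ m) ! ℕ.* (m ! ℕ.* m !)

  num₁*num₂≡[p+N]! : num₁ ℕ.* num₂ ≡ (p ℕ.+ N) !
  num₁*num₂≡[p+N]! = begin
    num₁ ℕ.* num₂
      ≡⟨ cong₂ ℕ._*_ (cong (ℕ._+ 1) (sym (ℕ.*-distribʳ-∸ m 6 2)))
                     (cong₂ (λ u v → (2 ℕ.* m ℕ.+ 2 ℕ.* m) ! ℕ.* u ℕ.* v)
                            (cong _! (ℕ.n∸n≡0 (2 ℕ.* m))) (cong₂ _C_ (ℕ.n∸n≡0 (2 ℕ.* m)) (ℕ.n∸n≡0 m))) ⟩
    (4 ℕ.* m ℕ.+ 1) ℕ.* ((2 ℕ.* m ℕ.+ 2 ℕ.* m) ! ℕ.* 1 ℕ.* 1)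
      ≡⟨ cong₂ ℕ._*_ (linear m) (trans (ℕ.*-identityʳ _) (ℕ.*-identityʳ _)) ⟩
    suc (2 ℕ.* m ℕ.+ 2 ℕ.* m) !
      ≡⟨ cong _! (linear′ m) ⟩
    (p ℕ.+ N) ! ∎
    where
    open ≡-Reasoning
    linear : ∀ m → 4 ℕ.* m ℕ.+ 1 ≡ suc (2 ℕ.* m ℕ.+ 2 ℕ.* m)
    linear = ℕ-solve-∀
    linear′ : ∀ m → suc (2 ℕ.* m ℕ.+ 2 ℕ.* m) ≡ suc (m ℕ.+ m) ℕ.+ (m ℕ.+ m)
    linear′ = ℕ-solve-∀

  numerator : -1ℤ ^ (m ℕ.+ m) * + num₁ * + num₂ ≡ P * W * ∏ N (λ k → + k + P)
  numerator = begin
    -1ℤ ^ (m ℕ.+ m) * + num₁ * + num₂      ≡⟨ ℤ.*-assoc (-1ℤ ^ (m ℕ.+ m)) (+ num₁) (+ num₂) ⟩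
    -1ℤ ^ (m ℕ.+ m) * (+ num₁ * + num₂)    ≡⟨ cong₂ _*_ (-1^[n+n]≡1 m)
                                                      (trans (sym (ℤ.pos-* num₁ num₂)) (cong +_ num₁*num₂≡[p+N]!)) ⟩
    1ℤ * + ((p ℕ.+ N) !)                   ≡⟨ ℤ.*-identityˡ _ ⟩
    + ((p ℕ.+ N) !)                        ≡⟨ !*∏-rising p N ⟨
    + (p !) * ∏ N (λ k → + k + P)          ≡⟨ cong (_* ∏ N (λ k → + k + P)) (ℤ.pos-* p (N !)) ⟩
    P * W * ∏ N (λ k → + k + P)            ∎
    where open ≡-Reasoning

  den≡[2^m]^6*N!*m!² : den ≡ (2 ℕ.^ m) ℕ.^ 6 ℕ.* N ! ℕ.* (m ! ℕ.* m !)
  den≡[2^m]^6*N!*m!² = begin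
    den
      ≡⟨ cong₂ (λ e c → 2 ℕ.^ e ℕ.* N ! ℕ.* c ℕ.* (m ! ℕ.* m !))
               (trans (sym (ℕ.*-distribʳ-∸ m 9 3)) (ℕ.*-comm 6 m)) (cong _! (ℕ.n∸n≡0 m)) ⟩
    2 ℕ.^ (m ℕ.* 6) ℕ.* N ! ℕ.* 1 ℕ.* (m ! ℕ.* m !)
      ≡⟨ cong (ℕ._* (m ! ℕ.* m !)) (trans (ℕ.*-identityʳ _) (cong (ℕ._* N !) (sym (ℕ.^-*-assoc 2 m 6)))) ⟩
    (2 ℕ.^ m) ℕ.^ 6 ℕ.* N ! ℕ.* (m ! ℕ.* m !) ∎
    where open ≡-Reasoning

  pos-den : + den ≡ T ^ 6 * W * (h * h)
  pos-den = begin
    + den                                        ≡⟨ cong +_ den≡[2^m]^6*N!*m!² ⟩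
    + ((2 ℕ.^ m) ℕ.^ 6 ℕ.* N ! ℕ.* (m ! ℕ.* m !))  ≡⟨ ℤ.pos-* ((2 ℕ.^ m) ℕ.^ 6 ℕ.* N !) (m ! ℕ.* m !) ⟩
    + ((2 ℕ.^ m) ℕ.^ 6 ℕ.* N !) * + (m ! ℕ.* m !)  ≡⟨ cong₂ _*_ (ℤ.pos-* ((2 ℕ.^ m) ℕ.^ 6) (N !)) (ℤ.pos-* (m !) (m !)) ⟩
    + ((2 ℕ.^ m) ℕ.^ 6) * W * (h * h)              ≡⟨ cong (λ t → t * W * (h * h))
                                                          (trans (pos-^ (2 ℕ.^ m) 6) (cong (_^ 6) (pos-^ 2 m))) ⟩
    T ^ 6 * W * (h * h)                          ∎
    where open ≡-Reasoning

  P∤den : ¬ P ∣ + den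
  P∤den P∣den = ∤-* p-prime (∤-* p-prime (P∤T^ 6) P∤W) (∤-* p-prime P∤h P∤h) (subst (P ∣_) pos-den P∣den)

open import Data.Nat using (_/_; _^_)
open import Data.Rational as ℚ using (ℚ; _+_; _*_; _-_; -_; 1ℚ; toℚᵘ)
import Data.Rational.Properties as ℚ
open import Data.Rational.Solver using (module +-*-Solver)
open import Data.Rational.Unnormalised using (mkℚᵘ; *≡*) renaming (_≃_ to _≃ᵘ_)
import Data.Rational.Unnormalised.Properties as ℚᵘ

private
  toℚᵘ-ℤ→ℚ : ∀ z → toℚᵘ (ℤ→ℚ z) ≃ᵘ mkℚᵘ z 0
  toℚᵘ-ℤ→ℚ z = ℚ.toℚᵘ-fromℚᵘ (mkℚᵘ z 0)

ℤ→ℚ-homo-+ : ∀ a b → ℤ→ℚ (a ℤ.+ b) ≡ ℤ→ℚ a + ℤ→ℚ b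
ℤ→ℚ-homo-+ a b = ℚ.toℚᵘ-injective (ℚᵘ.≃-trans (toℚᵘ-ℤ→ℚ (a ℤ.+ b)) (ℚᵘ.≃-sym (ℚᵘ.≃-trans
  (ℚ.toℚᵘ-homo-+ (ℤ→ℚ a) (ℤ→ℚ b)) (ℚᵘ.≃-trans (ℚᵘ.+-cong (toℚᵘ-ℤ→ℚ a) (toℚᵘ-ℤ→ℚ b)) (*≡* (unit-denominators a b))))))
  where
  unit-denominators : ∀ a b → (a ℤ.* ℤ.1ℤ ℤ.+ b ℤ.* ℤ.1ℤ) ℤ.* ℤ.1ℤ ≡ (a ℤ.+ b) ℤ.* ℤ.1ℤ
  unit-denominators = solve-∀

ℤ→ℚ-homo-* : ∀ a b → ℤ→ℚ (a ℤ.* b) ≡ ℤ→ℚ a * ℤ→ℚ b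
ℤ→ℚ-homo-* a b = ℚ.toℚᵘ-injective (ℚᵘ.≃-trans (toℚᵘ-ℤ→ℚ (a ℤ.* b)) (ℚᵘ.≃-sym
  (ℚᵘ.≃-trans (ℚ.toℚᵘ-homo-* (ℤ→ℚ a) (ℤ→ℚ b)) (ℚᵘ.*-cong (toℚᵘ-ℤ→ℚ a) (toℚᵘ-ℤ→ℚ b)))))

ℤ→ℚ-homo‿- : ∀ a → ℤ→ℚ (ℤ.- a) ≡ - ℤ→ℚ a
ℤ→ℚ-homo‿- a = ℚ.toℚᵘ-injective (ℚᵘ.≃-trans (toℚᵘ-ℤ→ℚ (ℤ.- a)) (ℚᵘ.≃-sym
  (ℚᵘ.≃-trans (ℚ.toℚᵘ-homo‿- (ℤ→ℚ a)) (ℚᵘ.-‿cong (toℚᵘ-ℤ→ℚ a)))))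

ℤ→ℚ-homo-- : ∀ a b → ℤ→ℚ (a ℤ.- b) ≡ ℤ→ℚ a - ℤ→ℚ b
ℤ→ℚ-homo-- a b = trans (ℤ→ℚ-homo-+ a (ℤ.- b)) (cong (λ x → ℤ→ℚ a + x) (ℤ→ℚ-homo‿- b))

ℕ→ℚ*recipℕ : ∀ d → d ≢ 0 → ℕ→ℚ d * recipℕ d ≡ 1ℚ
ℕ→ℚ*recipℕ zero    d≢0 = contradiction refl d≢0
ℕ→ℚ*recipℕ (suc d) _   = ℚ.toℚᵘ-injective (ℚᵘ.≃-trans (ℚ.toℚᵘ-homo-* (ℕ→ℚ (suc d)) (recipℕ (suc d)))
  (ℚᵘ.≃-trans (ℚᵘ.*-cong (toℚᵘ-ℤ→ℚ (+ suc d)) (ℚ.toℚᵘ-fromℚᵘ (mkℚᵘ (+ 1) d))) (*≡* (unit-denominators (+ suc d)))))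
  where
  unit-denominators : ∀ x → (x ℤ.* + 1) ℤ.* ℤ.1ℤ ≡ ℤ.1ℤ ℤ.* (ℤ.1ℤ ℤ.* x)
  unit-denominators = solve-∀

congModPow-fraction : ∀ {p e d x y} → ¬ + p ∣ + d → + (p ^ e) ∣ x ℤ.- + d ℤ.* y →
                      CongModPow p e (ℤ→ℚ x * recipℕ d) (ℤ→ℚ y)
congModPow-fraction {p} {e} {d} {x} {y} P∤d (divides u x-dy≡upᵉ) = u , d , P∤d ∘ ∣ᵤ⇒∣ , (begin
  ℕ→ℚ d * (ℤ→ℚ x * recipℕ d - ℤ→ℚ y)          ≡⟨ solve 4 (λ D X R Y → D :* (X :* R :- Y) := X :* (D :* R) :- D :* Y)
                                                        refl (ℕ→ℚ d) (ℤ→ℚ x) (recipℕ d) (ℤ→ℚ y) ⟩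
  ℤ→ℚ x * (ℕ→ℚ d * recipℕ d) - ℕ→ℚ d * ℤ→ℚ y  ≡⟨ cong₂ (λ r t → ℤ→ℚ x * r - t) (ℕ→ℚ*recipℕ d d≢0)
                                                         (sym (ℤ→ℚ-homo-* (+ d) y)) ⟩
  ℤ→ℚ x * 1ℚ - ℤ→ℚ (+ d ℤ.* y)                 ≡⟨ cong (_- ℤ→ℚ (+ d ℤ.* y)) (ℚ.*-identityʳ (ℤ→ℚ x)) ⟩
  ℤ→ℚ x - ℤ→ℚ (+ d ℤ.* y)                      ≡⟨ ℤ→ℚ-homo-- x (+ d ℤ.* y) ⟨
  ℤ→ℚ (x ℤ.- + d ℤ.* y)                        ≡⟨ cong ℤ→ℚ (trans x-dy≡upᵉ (ℤ.*-comm u _)) ⟩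
  ℤ→ℚ (+ (p ^ e) ℤ.* u)                        ≡⟨ ℤ→ℚ-homo-* (+ (p ^ e)) u ⟩
  ℕ→ℚ (p ^ e) * ℤ→ℚ u                          ∎)
  where
  open ≡-Reasoning
  open +-*-Solver
  d≢0 : d ≢ 0
  d≢0 refl = P∤d (∣ᵤ⇒∣ (p ℕ.∣0))

module _ (m : ℕ) (p-prime : Prime (suc (m ℕ.+ m))) (3<p : 3 < suc (m ℕ.+ m)) where

  open OddPrime m p-prime 3<p

  F[m,m]≡fraction : F m m ≡ ℤ→ℚ (P ℤ.* W ℤ.* ∏ N (λ k → + k ℤ.+ P)) * recipℕ den
  F[m,m]≡fraction = cong (_* recipℕ den) (begin
    sgn (m ℕ.+ m) * ℕ→ℚ num₁ * ℕ→ℚ num₂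
      ≡⟨ cong (_* ℕ→ℚ num₂) (ℤ→ℚ-homo-* (ℤ.-1ℤ ℤ.^ (m ℕ.+ m)) (+ num₁)) ⟨
    ℤ→ℚ (ℤ.-1ℤ ℤ.^ (m ℕ.+ m) ℤ.* + num₁) * ℕ→ℚ num₂
      ≡⟨ ℤ→ℚ-homo-* (ℤ.-1ℤ ℤ.^ (m ℕ.+ m) ℤ.* + num₁) (+ num₂) ⟨
    ℤ→ℚ (ℤ.-1ℤ ℤ.^ (m ℕ.+ m) ℤ.* + num₁ ℤ.* + num₂)
      ≡⟨ cong ℤ→ℚ numerator ⟩
    ℤ→ℚ (P ℤ.* W ℤ.* ∏ N (λ k → + k ℤ.+ P)) ∎)
    where open ≡-Reasoning

  q≡s : q p ≡ ℤ→ℚ s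
  q≡s = begin
    ℤ→ℚ (+ (2 ^ (m ℕ.+ m)) ℤ.- + 1) * recipℕ p  ≡⟨ cong (λ z → ℤ→ℚ (z ℤ.- + 1) * recipℕ p)
                                                       (trans (pos-^ 2 (m ℕ.+ m)) (ℤ.^-distribˡ-+-* (+ 2) m m)) ⟩
    ℤ→ℚ (T ℤ.* T ℤ.- ℤ.1ℤ) * recipℕ p             ≡⟨ cong (λ z → ℤ→ℚ z * recipℕ p) T²-1≡sP ⟩
    ℤ→ℚ (s ℤ.* P) * recipℕ p                     ≡⟨ cong (_* recipℕ p) (ℤ→ℚ-homo-* s P) ⟩
    ℤ→ℚ s * ℕ→ℚ p * recipℕ p                     ≡⟨ ℚ.*-assoc (ℤ→ℚ s) (ℕ→ℚ p) (recipℕ p) ⟩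
    ℤ→ℚ s * (ℕ→ℚ p * recipℕ p)                   ≡⟨ cong (ℤ→ℚ s *_) (ℕ→ℚ*recipℕ p (λ ())) ⟩
    ℤ→ℚ s * 1ℚ                                   ≡⟨ ℚ.*-identityʳ (ℤ→ℚ s) ⟩
    ℤ→ℚ s                                        ∎
    where open ≡-Reasoning

  rhs≡ : sgn m * ℕ→ℚ p * ((1ℚ - ℕ→ℚ p * q p) + ℕ→ℚ (p ^ 2) * (q p * q p))
         ≡ ℤ→ℚ (σ ℤ.* P ℤ.* (ℤ.1ℤ ℤ.- P ℤ.* s ℤ.+ P ℤ.^ 2 ℤ.* (s ℤ.* s)))
  rhs≡ = begin
    sgn m * ℕ→ℚ p * ((1ℚ - ℕ→ℚ p * q p) + ℕ→ℚ (p ^ 2) * (q p * q p))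
      ≡⟨ cong (λ z → sgn m * ℕ→ℚ p * ((1ℚ - ℕ→ℚ p * z) + ℕ→ℚ (p ^ 2) * (z * z))) q≡s ⟩
    ℤ→ℚ σ * ℤ→ℚ P * ((ℤ→ℚ ℤ.1ℤ - ℤ→ℚ P * ℤ→ℚ s) + ℤ→ℚ (+ (p ^ 2)) * (ℤ→ℚ s * ℤ→ℚ s))
      ≡⟨ cong₂ (λ u v → ℤ→ℚ σ * ℤ→ℚ P * ((ℤ→ℚ ℤ.1ℤ - u) + ℤ→ℚ (+ (p ^ 2)) * v)) (ℤ→ℚ-homo-* P s) (ℤ→ℚ-homo-* s s) ⟨
    ℤ→ℚ σ * ℤ→ℚ P * ((ℤ→ℚ ℤ.1ℤ - ℤ→ℚ (P ℤ.* s)) + ℤ→ℚ (+ (p ^ 2)) * ℤ→ℚ (s ℤ.* s))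
      ≡⟨ cong₂ (λ u v → ℤ→ℚ σ * ℤ→ℚ P * (u + v)) (ℤ→ℚ-homo-- ℤ.1ℤ (P ℤ.* s)) (ℤ→ℚ-homo-* (+ (p ^ 2)) (s ℤ.* s)) ⟨
    ℤ→ℚ σ * ℤ→ℚ P * (ℤ→ℚ (ℤ.1ℤ ℤ.- P ℤ.* s) + ℤ→ℚ (+ (p ^ 2) ℤ.* (s ℤ.* s)))
      ≡⟨ cong₂ _*_ (ℤ→ℚ-homo-* σ P) (ℤ→ℚ-homo-+ (ℤ.1ℤ ℤ.- P ℤ.* s) (+ (p ^ 2) ℤ.* (s ℤ.* s))) ⟨
    ℤ→ℚ (σ ℤ.* P) * ℤ→ℚ (ℤ.1ℤ ℤ.- P ℤ.* s ℤ.+ + (p ^ 2) ℤ.* (s ℤ.* s))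
      ≡⟨ ℤ→ℚ-homo-* (σ ℤ.* P) _ ⟨
    ℤ→ℚ (σ ℤ.* P ℤ.* (ℤ.1ℤ ℤ.- P ℤ.* s ℤ.+ + (p ^ 2) ℤ.* (s ℤ.* s)))
      ≡⟨ cong (λ z → ℤ→ℚ (σ ℤ.* P ℤ.* (ℤ.1ℤ ℤ.- P ℤ.* s ℤ.+ z ℤ.* (s ℤ.* s)))) (pos-^ p 2) ⟩
    ℤ→ℚ (σ ℤ.* P ℤ.* (ℤ.1ℤ ℤ.- P ℤ.* s ℤ.+ P ℤ.^ 2 ℤ.* (s ℤ.* s))) ∎
    where open ≡-Reasoning

  F[m,m]-congruence : CongModPow p 4 (F m m) (sgn m * ℕ→ℚ p * ((1ℚ - ℕ→ℚ p * q p) + ℕ→ℚ (p ^ 2) * (q p * q p)))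
  F[m,m]-congruence = subst₂ (CongModPow p 4) (sym F[m,m]≡fraction) (sym rhs≡)
    (congModPow-fraction {e = 4} {x = x} {y = y} P∤den
      (subst₂ _∣_ (sym (pos-^ p 4)) (cong (λ d → x ℤ.- d ℤ.* y) (sym pos-den)) (∣-difference main-congruence)))
    where
    x y : ℤ
    x = P ℤ.* W ℤ.* ∏ N (λ k → + k ℤ.+ P)
    y = σ ℤ.* P ℤ.* (ℤ.1ℤ ℤ.- P ℤ.* s ℤ.+ P ℤ.^ 2 ℤ.* (s ℤ.* s))

prime>2⇒∤2 : ∀ {p} → Prime p → 2 < p → ¬ 2 ℕ.∣ p
prime>2⇒∤2 p-prime 2<p 2∣p with prime⇒irreducible p-prime 2∣p
... | inj₂ refl = ℕ.<-irrefl refl 2<p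

odd-prime-shape : ∀ {p} → Prime p → 3 < p → p ≡ suc ((p ∸ 1) / 2 ℕ.+ (p ∸ 1) / 2)
odd-prime-shape {suc n} p-prime 3<p with n % 2 | m%n<n n 2 | m≡m%n+[m/n]*n n 2
... | 0           | _             | n≡[n/2]*2   = cong suc (trans n≡[n/2]*2 (double (n / 2)))
  where
  double : ∀ x → x ℕ.* 2 ≡ x ℕ.+ x
  double = ℕ-solve-∀
... | 1           | _             | n≡1+[n/2]*2 = contradiction (ℕ.divides (suc (n / 2)) (cong suc n≡1+[n/2]*2))
                                                    (prime>2⇒∤2 p-prime (ℕ.<-trans (ℕ.n<1+n 2) 3<p))
... | suc (suc _) | s≤s (s≤s ())  | _

odd-prime-congruence : ∀ {p} m → p ≡ suc (m ℕ.+ m) → Prime p → 3 < p →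
  CongModPow p 4 (F m m) (sgn m * ℕ→ℚ p * ((1ℚ - ℕ→ℚ p * q p) + ℕ→ℚ (p ^ 2) * (q p * q p)))
odd-prime-congruence m refl = F[m,m]-congruence m

lemma3p2 : (p : ℕ) → Prime p → 3 < p →
    CongModPow p 4
      (F ((p ∸ 1) / 2) ((p ∸ 1) / 2))
      (sgn ((p ∸ 1) / 2) * ℕ→ℚ p * ((1ℚ - ℕ→ℚ p * q p) + ℕ→ℚ (p ^ 2) * (q p * q p)))
lemma3p2 p p-prime 3<p = odd-prime-congruence ((p ∸ 1) / 2) (odd-prime-shape p-prime 3<p) p-prime 3<p
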